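{- Let $d$ be a positive integer, $\boldsymbol\lambda = (\lambda_1,\dots,\lambda_m)$ parameters, $\mathcal{L} = \mathbb{Z}_{2^d}[\boldsymbol\lambda]$, $X$ a finite set of variables with a fixed well-ordered monomial ordering, $f \in \mathcal{L}[X]$ and $G$ a finite subset of $\mathbb{Z}_{2^d}[X]\setminus\{0\}$. Consider the procedure: while there exist $g\in G$ and a nonzero term $t = c_t m_t$ of $f$ (with $c_t \in \mathcal{L}$, $m_t$ a monomial in $X$) such that $\mathrm{lm}(g) \mid m_t$ and $\nu_2(\mathrm{lc}(g)) \le \bar\nu_2(c_t)$, replace $f$ by $$f - \frac{c_t}{2^{\nu_2(\mathrm{lc}(g))}}\cdot\Big(\frac{\mathrm{lc}(g)}{2^{\nu_2(\mathrm{lc}(g))}}\Big)^{ -1}\cdot\frac{m_t}{\mathrm{lm}(g)}\cdot g;$$ when no such $g,t$ exist, return $\mathrm{PNF}_G(f) := f$. Then this procedure always terminates, and the map $f \mapsto \mathrm{PNF}_G(f)$ is a valid parametric normal form, i.e. (1) $\mathrm{PNF}_G(0) = 0$; (2) if $\mathrm{PNF}_G(f)\neq 0$ then $\mathrm{lt}(\mathrm{PNF}_G(f)) \notin \langle \mathrm{lt}(g)\rangle_{\mathcal{L}[X]}$ for every $g\in G$; (3) $f - \mathrm{PNF}_G(f)$ belongs to the ideal of $\mathcal{L}[X]$ generated by $G$.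
   Context: $\mathbb{Z}_{2^d}$ is the ring of integers modulo $2^d$; for nonzero $a\in\mathbb{Z}_{2^d}$, $\nu_2(a)$ is the largest $k$ with $2^k\mid a$. For nonzero $c\in\mathcal{L}$ (a polynomial in $\boldsymbol\lambda$), $\bar\nu_2(c)$ is the minimum of $\nu_2$ over the nonzero coefficients of $c$ (e.g. $\bar\nu_2(2\lambda_1+4\lambda_2) = 1$). When $\bar\nu_2(c)\ge k$, $c/2^k$ denotes the element of $\mathcal{L}$ obtained by dividing each coefficient of $c$ by $2^k$. For odd $s$, $s^{ -1}$ denotes its inverse in $\mathbb{Z}_{2^d}$. A well-ordered monomial ordering is a total order on monomials with $1 \prec$ every nonconstant monomial and $p\prec q \Rightarrow pr\prec qr$; $\mathrm{lm},\mathrm{lc},\mathrm{lt}$ are the leading monomial, coefficient and term with respect to it (for elements of $\mathcal{L}[X]$, coefficients lie in $\mathcal{L}$). -}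

module Defs where

open import Level using (0ℓ)
open import Data.Nat as ℕ using (ℕ; zero; suc; _≤_; _^_; NonZero)
open import Data.Nat.Properties using (m^n≢0)
open import Data.Integer as ℤ using (ℤ; +_; _%ℕ_)
open import Data.Product using (Σ; proj₁; proj₂; ∃; ∃-syntax; _×_; _,_)
open import Data.List using (List; []; _∷_; [_]; map; concatMap; foldr; _++_)
open import Data.List.Membership.Propositional using (_∈_)
open import Data.List.Relation.Unary.All using (All)
open import Data.Vec using (Vec; replicate; zipWith)
import Data.Vec.Properties as VecP
import Data.Product.Properties as ProdP
open import Data.Vec.Relation.Binary.Pointwise.Inductive using (Pointwise)
open import Data.Sum using (_⊎_)
open import Relation.Binary.Definitions using (DecidableEquality)
open import Relation.Binary.Structures using (IsStrictTotalOrder)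
open import Relation.Binary.PropositionalEquality using (_≡_; _≢_)
open import Relation.Nullary using (¬_; yes; no)
open import Induction.WellFounded using (WellFounded)

_·ₘ_ : ∀ {k} → Vec ℕ k → Vec ℕ k → Vec ℕ k
_·ₘ_ = zipWith ℕ._+_

-- quotient of monomials (used only when the divisor divides)
_/ₘ_ : ∀ {k} → Vec ℕ k → Vec ℕ k → Vec ℕ k
_/ₘ_ = zipWith ℕ._∸_

_∣ₘ_ : ∀ {k} → Vec ℕ k → Vec ℕ k → Set
_∣ₘ_ = Pointwise _≤_

𝟙 : ∀ {k} → Vec ℕ k
𝟙 {k} = replicate k 0

record MonomialOrder (n : ℕ) : Set₁ where
  field
    _≺_           : Vec ℕ n → Vec ℕ n → Set
    isStrictTotal : IsStrictTotalOrder _≡_ _≺_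
    one-least     : ∀ p → p ≢ 𝟙 → 𝟙 ≺ p
    mult-compat   : ∀ p q r → p ≺ q → (p ·ₘ r) ≺ (q ·ₘ r)
    well-ordered  : WellFounded _≺_

  _≼_ : Vec ℕ n → Vec ℕ n → Set
  p ≼ q = p ≺ q ⊎ p ≡ q

-- Polynomials with coefficients in ℤ_{2^d}, represented as finite lists of
-- terms (coefficient given by an integer representative, monomial);
-- the polynomial denoted is the sum of the terms.  The coefficient of a
-- monomial is read off as the canonical representative in {0,…,2^d-1}.

Poly : Set → Set
Poly Mon = List (ℤ × Mon)

_mod2^_ : ℕ → ℕ → ℕ
a mod2^ k = ℕ._%_ a (2 ^ k) ⦃ m^n≢0 2 k ⦄

_div2^_ : ℕ → ℕ → ℕ
a div2^ k = ℕ._/_ a (2 ^ k) ⦃ m^n≢0 2 k ⦄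

module _ (d : ℕ) where

  red : ℤ → ℕ
  red z = _%ℕ_ z (2 ^ d) ⦃ m^n≢0 2 d ⦄

  coeff : ∀ {Mon : Set} → DecidableEquality Mon → Poly Mon → Mon → ℕ
  coeff {Mon} _≟_ p μ = red (sumℤ p)
    where
    sumℤ : Poly Mon → ℤ
    sumℤ [] = + 0
    sumℤ ((a , ν) ∷ q) with ν ≟ μ
    ... | yes _ = a ℤ.+ sumℤ q
    ... | no  _ = sumℤ q

  _∣ᵣ_ : ℕ → ℕ → Set
  b ∣ᵣ a = ∃[ c ] ((b ℕ.* c) mod2^ d ≡ a)

  ν₂≡ : ℕ → ℕ → Set
  ν₂≡ a k = a ≢ 0 × (2 ^ k) ∣ᵣ a × (∀ j → (2 ^ j) ∣ᵣ a → j ≤ k)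

  -- ν̄₂ of a nonzero element of ℒ, given by its coefficient function:
  -- the minimum of ν₂ over the nonzero coefficients.
  ν̄₂≡ : ∀ {m} → (Vec ℕ m → ℕ) → ℕ → Set
  ν̄₂≡ c k = (∃[ μ ] ν₂≡ (c μ) k)
           × (∀ μ j → ν₂≡ (c μ) j → k ≤ j)

  module Polys (m n : ℕ) where

    PolyX : Set
    PolyX = Poly (Vec ℕ n)

    PolyΛ : Set
    PolyΛ = Poly (Vec ℕ m)

    -- ℒ[X] = ℤ_{2^d}[λ][X]; a monomial is a pair (λ-exponent, X-exponent)
    PolyLX : Set
    PolyLX = Poly (Vec ℕ m × Vec ℕ n)

    decX : DecidableEquality (Vec ℕ n)
    decX = VecP.≡-dec ℕ._≟_

    decΛ : DecidableEquality (Vec ℕ m)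
    decΛ = VecP.≡-dec ℕ._≟_

    decLX : DecidableEquality (Vec ℕ m × Vec ℕ n)
    decLX = ProdP.≡-dec decΛ decX

    coeffX : PolyX → Vec ℕ n → ℕ
    coeffX = coeff decX

    coeffΛ : PolyΛ → Vec ℕ m → ℕ
    coeffΛ = coeff decΛ

    coeffLX : PolyLX → Vec ℕ m → Vec ℕ n → ℕ
    coeffLX f μ x = coeff decLX f (μ , x)

    coeffL : PolyLX → Vec ℕ n → (Vec ℕ m → ℕ)
    coeffL f x μ = coeffLX f μ x

    _≈X_ : PolyX → PolyX → Set
    p ≈X q = ∀ x → coeffX p x ≡ coeffX q x

    _≈_ : PolyLX → PolyLX → Set
    p ≈ q = ∀ μ x → coeffLX p μ x ≡ coeffLX q μ x

    0ₚ : PolyLX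
    0ₚ = []

    _+ₚ_ : PolyLX → PolyLX → PolyLX
    _+ₚ_ = _++_

    -ₚ_ : PolyLX → PolyLX
    -ₚ_ = map (λ { (a , t) → (ℤ.- a , t) })

    _-ₚ_ : PolyLX → PolyLX → PolyLX
    p -ₚ q = p +ₚ (-ₚ q)

    _*ₚ_ : PolyLX → PolyLX → PolyLX
    p *ₚ q = concatMap (λ { (a , (μ , x)) →
               map (λ { (b , (ν , y)) → (a ℤ.* b , (μ ·ₘ ν , x ·ₘ y)) }) q }) p

    embΛ : PolyΛ → PolyLX
    embΛ = map (λ { (a , μ) → (a , (μ , 𝟙)) })

    embX : PolyX → PolyLX
    embX = map (λ { (a , x) → (a , (𝟙 , x)) })

    termX : ℕ → Vec ℕ n → PolyLX
    termX a x = [ (+ a , (𝟙 , x)) ]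

    InIdeal : PolyLX → List PolyX → Set
    InIdeal p G = Σ (List (PolyLX × PolyX)) λ hs → All (λ hg → proj₂ hg ∈ G) hs
                  × p ≈ foldr (λ hg r → (proj₁ hg *ₚ embX (proj₂ hg)) +ₚ r) 0ₚ hs

    InPrincipal : PolyLX → PolyLX → Set
    InPrincipal p q = ∃[ h ] p ≈ (h *ₚ q)

    module WithOrder (O : MonomialOrder n) where
      open MonomialOrder O

      IsLMX : PolyX → Vec ℕ n → Set
      IsLMX g x = coeffX g x ≢ 0 × (∀ y → coeffX g y ≢ 0 → y ≼ x)

      OccursLX : PolyLX → Vec ℕ n → Set
      OccursLX f x = ∃[ μ ] coeffLX f μ x ≢ 0

      IsLMLX : PolyLX → Vec ℕ n → Set
      IsLMLX f x = OccursLX f x × (∀ y → OccursLX f y → y ≼ x)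

      IsLT : PolyLX → PolyLX → Set
      IsLT f T = ∃[ x ] IsLMLX f x
                 × (∀ μ → coeffLX T μ x ≡ coeffLX f μ x)
                 × (∀ μ y → y ≢ x → coeffLX T μ y ≡ 0)

      module Procedure (G : List PolyX) where

        record Redex (f : PolyLX) : Set where
          field
            g      : PolyX
            g∈G    : g ∈ G
            lmg    : Vec ℕ n
            isLM   : IsLMX g lmg
            mt     : Vec ℕ n          -- m_t ; the term is c_t m_t, c_t = coeffL f mt
            occurs : OccursLX f mt
            divides : lmg ∣ₘ mt
            k      : ℕ
            νk     : ν₂≡ (coeffX g lmg) k
            kbar   : ℕ
            νbar   : ν̄₂≡ (coeffL f mt) kbar
            k≤kbar : k ≤ kbar

        Step : PolyLX → PolyLX → Set
        Step f f' = Σ (Redex f) λ r → let open Redex r in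
          ∃[ C ] (∀ μ → coeffΛ C μ ≡ coeffL f mt μ div2^ k)
          × ∃[ u ] ((coeffX g lmg div2^ k) ℕ.* u) mod2^ d ≡ 1 mod2^ d
          × f' ≈ (f -ₚ ((embΛ C *ₚ termX u (mt /ₘ lmg)) *ₚ embX g))

        Irreducible : PolyLX → Set
        Irreducible f = ¬ Redex f

-- Let k = ν₂(lc g). Since 2^k divides every coefficient of c_t and lc(g)/2^k is odd, hence invertible,
-- the multiple of g subtracted in a step has coefficient exactly c_t at m_t; as lm(g) leads g, it has
-- no monomial above m_t. So a step removes m_t from the support of f and keeps the support above m_t:
-- on finite sets of monomials this is the multiset extension of the well-order ≺, so reduction terminates.
-- A multiple of lt(g) has X-degrees divisible by lm(g) and coefficients divisible by 2^k, so it is never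
-- the leading term of an irreducible polynomial; and f − PNF_G(f) is the sum of the subtracted multiples.

module Submission where

open import Defs
open import Level using (0ℓ)
open import Data.Empty using (⊥)
open import Data.Unit using (⊤; tt)
open import Data.Sum using (_⊎_; inj₁; inj₂)
open import Data.Product using (_×_; _,_; proj₁; proj₂; ∃₂; ∃-syntax; map₁; map₂)
open import Function using (id; _∘_; flip; _on_; _⇔_; Equivalence; mk⇔)
open import Data.Nat as ℕ using (ℕ; zero; suc; _≤_; _<_; _^_; _∸_; NonZero)
import Data.Nat.Properties as ℕP
open import Data.Nat.Properties using (m^n≢0)
open import Data.Nat.DivMod
  using (m/n≤m; 0/n≡0; %-distribˡ-*; [m+kn]%n≡m%n; m<n⇒m%n≡m; m*[n/m]≡n; m/n*n≡m)
open import Data.Nat.Divisibility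
  using (_∣_; _∣?_; divides; _∣0; 1∣_; ∣-trans; ∣⇒≤; m∣m*n; n∣m*n; ∣m⇒∣m*n; n∣m⇒m%n≡0; %-presˡ-∣; m∣n/o⇒m*o∣n)
open import Data.Nat.Solver using () renaming (module +-*-Solver to ℕ-Solver)
open import Data.Integer as ℤ using (ℤ; +_; -[1+_]; _/ℕ_)
import Data.Integer.Properties as ℤP
open import Data.Integer.DivMod using (a≡a%ℕn+[a/ℕn]*n; n%ℕd<d)
open import Data.Integer.Solver using () renaming (module +-*-Solver to ℤ-Solver)
open import Data.List using (List; []; _∷_; [_]; _++_; map; foldr)
open import Data.List.Properties using (++-identityʳ)
open import Data.List.Membership.Propositional using (_∈_; _∉_; find; lose)
open import Data.List.Membership.Propositional.Properties using (∈-map⁺)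
open import Data.List.Relation.Unary.Any using (here; there; any?)
open import Data.List.Relation.Unary.All using (All; []; _∷_)
open import Data.Vec using (Vec; []; _∷_)
import Data.Vec.Relation.Binary.Pointwise.Inductive as Pointwise
open Pointwise using ([]; _∷_)
open import Relation.Nullary using (¬_; ¬?; contradiction; Dec; yes; no)
open import Relation.Nullary.Decidable using (decidable-stable)
open import Relation.Binary.PropositionalEquality
  using (_≡_; _≢_; refl; sym; trans; cong; cong₂; subst; subst₂; module ≡-Reasoning)
open import Relation.Binary.Definitions using (DecidableEquality; Reflexive; Transitive; Total; tri<; tri≈; tri>)
open import Relation.Binary.Structures using (IsEquivalence; IsStrictTotalOrder)
open import Relation.Binary.Bundles using (Setoid; StrictTotalOrder)
import Relation.Binary.Construct.On as On
import Relation.Binary.Reasoning.Setoid as SetoidReasoning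
open import Relation.Binary.Construct.Closure.ReflexiveTransitive using (Star; ε; _◅_)
open import Induction.WellFounded using (WellFounded; Acc; acc; module Subrelation)
module Reduction (d : ℕ) where

  open import Data.Integer using (_+_; _*_; _-_; -_)
  open ℤ-Solver

  N : ℕ
  N = 2 ^ d

  instance
    N≢0 : NonZero N
    N≢0 = m^n≢0 2 d

  red<N : ∀ z → red d z < N
  red<N z = n%ℕd<d z N

  red-decomposition : ∀ z → z ≡ + red d z + (z /ℕ N) * + N
  red-decomposition z = a≡a%ℕn+[a/ℕn]*n z N

  private
    ≥N : ∀ r q → N ℕ.≤ r ℕ.+ suc q ℕ.* N
    ≥N r q = ℕP.≤-trans (ℕP.m≤m+n N (q ℕ.* N)) (ℕP.m≤n+m (suc q ℕ.* N) r)

    plus-multiple : ∀ r q → + r + + suc q * + N ≡ + (r ℕ.+ suc q ℕ.* N)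
    plus-multiple r q = cong (_+_ (+ r)) (sym (ℤP.pos-* (suc q) N))

    remainder-unique′ : ∀ {r r′} δ → r < N → r′ < N → + r ≡ + r′ + δ * + N → r ≡ r′
    remainder-unique′ (+ zero) _ _ e = ℤP.+-injective (trans e (ℤP.+-identityʳ _))
    remainder-unique′ {r} {r′} (+ suc q) r<N _ e =
      contradiction (subst (N ℕ.≤_) (sym (ℤP.+-injective (trans e (plus-multiple r′ q)))) (≥N r′ q))
                    (ℕP.<⇒≱ r<N)
    remainder-unique′ {r} {r′} -[1+ q ] _ r′<N e =
      contradiction (subst (N ℕ.≤_) (sym (ℤP.+-injective (trans e′ (plus-multiple r q)))) (≥N r q))
                    (ℕP.<⇒≱ r′<N)
      where
      e′ : + r′ ≡ + r + + suc q * + N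
      e′ = trans (solve 3 (λ a s n → a := (a :+ (:- s) :* n) :+ s :* n) refl (+ r′) (+ suc q) (+ N))
                 (cong (_+ + suc q * + N) (sym e))

  remainder-unique : ∀ {r r′} q q′ → r < N → r′ < N →
                     + r + q * + N ≡ + r′ + q′ * + N → r ≡ r′
  remainder-unique {r} {r′} q q′ r<N r′<N e = remainder-unique′ (q′ - q) r<N r′<N (begin
    + r                          ≡⟨ solve 3 (λ a b n → a := (a :+ b :* n) :- b :* n) refl (+ r) q (+ N) ⟩
    (+ r + q * + N) - q * + N    ≡⟨ cong (_- q * + N) e ⟩
    (+ r′ + q′ * + N) - q * + N
      ≡⟨ solve 4 (λ a b c n → (a :+ c :* n) :- b :* n := a :+ (c :- b) :* n) refl (+ r′) q q′ (+ N) ⟩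
    + r′ + (q′ - q) * + N        ∎)
    where open ≡-Reasoning

  red-+-multiple : ∀ z t → red d (z + t * + N) ≡ red d z
  red-+-multiple z t = remainder-unique (w /ℕ N) (z /ℕ N + t) (red<N w) (red<N z) (begin
    + red d w + (w /ℕ N) * + N                  ≡⟨ sym (red-decomposition w) ⟩
    z + t * + N                                  ≡⟨ cong (_+ t * + N) (red-decomposition z) ⟩
    (+ red d z + (z /ℕ N) * + N) + t * + N
      ≡⟨ solve 4 (λ a b c n → (a :+ b :* n) :+ c :* n := a :+ (b :+ c) :* n) refl (+ red d z) (z /ℕ N) t (+ N) ⟩
    + red d z + (z /ℕ N + t) * + N              ∎)
    where
    open ≡-Reasoning
    w : ℤ
    w = z + t * + N

  red-small : ∀ {r} → r < N → red d (+ r) ≡ r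
  red-small {r} r<N = remainder-unique (+ r /ℕ N) (+ 0) (red<N (+ r)) r<N
    (trans (sym (red-decomposition (+ r))) (solve 2 (λ a n → a := a :+ con (+ 0) :* n) refl (+ r) (+ N)))

  red-zero : red d (+ 0) ≡ 0
  red-zero = red-small (ℕP.m^n>0 2 d)

  red-idem : ∀ z → red d (+ red d z) ≡ red d z
  red-idem z = red-small (red<N z)

  infix 4 _≡ₘ_
  record _≡ₘ_ (z w : ℤ) : Set where
    constructor mk≡ₘ
    field red-≡ : red d z ≡ red d w
  open _≡ₘ_ public

  ≡ₘ-isEquivalence : IsEquivalence _≡ₘ_
  ≡ₘ-isEquivalence = record
    { refl  = mk≡ₘ refl
    ; sym   = λ (mk≡ₘ e) → mk≡ₘ (sym e)
    ; trans = λ (mk≡ₘ e) (mk≡ₘ e′) → mk≡ₘ (trans e e′)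
    }

  ≡ₘ-setoid : Setoid 0ℓ 0ℓ
  ≡ₘ-setoid = record { isEquivalence = ≡ₘ-isEquivalence }

  open IsEquivalence ≡ₘ-isEquivalence public
    using () renaming (refl to ≡ₘ-refl; sym to ≡ₘ-sym; trans to ≡ₘ-trans; reflexive to ≡⇒≡ₘ)

  module ≡ₘ-Reasoning = SetoidReasoning ≡ₘ-setoid

  red-≡ₘ : ∀ z → + red d z ≡ₘ z
  red-≡ₘ z = mk≡ₘ (red-idem z)

  red-+ : ∀ z w → red d (z + w) ≡ red d (+ red d z + + red d w)
  red-+ z w = trans (cong (red d) (begin
    z + w   ≡⟨ cong₂ _+_ (red-decomposition z) (red-decomposition w) ⟩
    (+ red d z + (z /ℕ N) * + N) + (+ red d w + (w /ℕ N) * + N)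
      ≡⟨ solve 5 (λ a b c e n → (a :+ b :* n) :+ (c :+ e :* n) := (a :+ c) :+ (b :+ e) :* n)
                 refl (+ red d z) (z /ℕ N) (+ red d w) (w /ℕ N) (+ N) ⟩
    (+ red d z + + red d w) + (z /ℕ N + w /ℕ N) * + N ∎))
    (red-+-multiple (+ red d z + + red d w) (z /ℕ N + w /ℕ N))
    where open ≡-Reasoning

  red-* : ∀ z w → red d (z * w) ≡ red d (+ red d z * + red d w)
  red-* z w = trans (cong (red d) (begin
    z * w   ≡⟨ cong₂ _*_ (red-decomposition z) (red-decomposition w) ⟩
    (+ red d z + (z /ℕ N) * + N) * (+ red d w + (w /ℕ N) * + N)
      ≡⟨ solve 5 (λ a b c e n → (a :+ b :* n) :* (c :+ e :* n) := (a :* c) :+ (a :* e :+ b :* c :+ b :* e :* n) :* n)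
                 refl (+ red d z) (z /ℕ N) (+ red d w) (w /ℕ N) (+ N) ⟩
    (+ red d z * + red d w) + t * + N ∎))
    (red-+-multiple (+ red d z * + red d w) t)
    where
    open ≡-Reasoning
    t : ℤ
    t = + red d z * (w /ℕ N) + (z /ℕ N) * + red d w + (z /ℕ N) * (w /ℕ N) * + N

  +-congₘ : ∀ {z z′ w w′} → z ≡ₘ z′ → w ≡ₘ w′ → z + w ≡ₘ z′ + w′
  +-congₘ {z} {z′} {w} {w′} (mk≡ₘ e) (mk≡ₘ e′) =
    mk≡ₘ (trans (red-+ z w) (trans (cong₂ (λ a b → red d (+ a + + b)) e e′) (sym (red-+ z′ w′))))

  *-congₘ : ∀ {z z′ w w′} → z ≡ₘ z′ → w ≡ₘ w′ → z * w ≡ₘ z′ * w′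
  *-congₘ {z} {z′} {w} {w′} (mk≡ₘ e) (mk≡ₘ e′) =
    mk≡ₘ (trans (red-* z w) (trans (cong₂ (λ a b → red d (+ a * + b)) e e′) (sym (red-* z′ w′))))

  +-congʳₘ : ∀ z {w w′} → w ≡ₘ w′ → z + w ≡ₘ z + w′
  +-congʳₘ z = +-congₘ (≡ₘ-refl {z})

  +-congˡₘ : ∀ w {z z′} → z ≡ₘ z′ → z + w ≡ₘ z′ + w
  +-congˡₘ w e = +-congₘ e (≡ₘ-refl {w})

  *-congʳₘ : ∀ z {w w′} → w ≡ₘ w′ → z * w ≡ₘ z * w′
  *-congʳₘ z = *-congₘ (≡ₘ-refl {z})

  *-congˡₘ : ∀ w {z z′} → z ≡ₘ z′ → z * w ≡ₘ z′ * w
  *-congˡₘ w e = *-congₘ e (≡ₘ-refl {w})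

  neg-congₘ : ∀ {z z′} → z ≡ₘ z′ → - z ≡ₘ - z′
  neg-congₘ {z} {z′} e = subst₂ _≡ₘ_ (ℤP.-1*i≡-i z) (ℤP.-1*i≡-i z′) (*-congʳₘ ℤ.-1ℤ e)

select : ∀ {P : Set} → Dec P → ℤ → ℤ
select (yes _) a = a
select (no _)  _ = + 0

select-yes : ∀ {P : Set} (D : Dec P) a → P → select D a ≡ a
select-yes (yes _) a _ = refl
select-yes (no ¬p) a p = contradiction p ¬p

select-no : ∀ {P : Set} (D : Dec P) a → ¬ P → select D a ≡ + 0
select-no (yes p) a ¬p = contradiction p ¬p
select-no (no _)  a _  = refl

select-*ʳ : ∀ {P : Set} (D : Dec P) a b → select D (a ℤ.* b) ≡ select D a ℤ.* b
select-*ʳ (yes _) a b = refl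
select-*ʳ (no _)  a b = sym (ℤP.*-zeroˡ b)

select-neg : ∀ {P : Set} (D : Dec P) a → select D (ℤ.- a) ≡ ℤ.- select D a
select-neg (yes _) a = refl
select-neg (no _)  a = refl

select-cong : ∀ {P Q : Set} (D : Dec P) (E : Dec Q) a → P ⇔ Q → select D a ≡ select E a
select-cong (yes p) E a P⇔Q = sym (select-yes E a (Equivalence.to P⇔Q p))
select-cong (no ¬p) E a P⇔Q = sym (select-no E a (¬p ∘ Equivalence.from P⇔Q))

module CoefficientSum {M : Set} (_≟_ : DecidableEquality M) where

  open import Data.Integer using (_+_)
  open import Data.List.Membership.DecPropositional _≟_ using (_∈?_)

  Σcoeff : Poly M → M → ℤ
  Σcoeff []            w = + 0
  Σcoeff ((a , v) ∷ p) w = select (v ≟ w) a + Σcoeff p w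

  coeff≡red-Σcoeff : ∀ d p w → coeff d _≟_ p w ≡ red d (Σcoeff p w)
  coeff≡red-Σcoeff d []            w = refl
  coeff≡red-Σcoeff d ((a , v) ∷ p) w with v ≟ w
  ... | yes _ = red-≡ (+-congʳₘ a (mk≡ₘ (coeff≡red-Σcoeff d p w)))
    where open Reduction d
  ... | no  _ = trans (coeff≡red-Σcoeff d p w) (cong (red d) (sym (ℤP.+-identityˡ (Σcoeff p w))))

  Σcoeff-++ : ∀ p q w → Σcoeff (p ++ q) w ≡ Σcoeff p w + Σcoeff q w
  Σcoeff-++ []            q w = sym (ℤP.+-identityˡ (Σcoeff q w))
  Σcoeff-++ ((a , v) ∷ p) q w =
    trans (cong (_+_ (select (v ≟ w) a)) (Σcoeff-++ p q w)) (sym (ℤP.+-assoc (select (v ≟ w) a) (Σcoeff p w) (Σcoeff q w)))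

  Σcoeff-∉ : ∀ p w → w ∉ map proj₂ p → Σcoeff p w ≡ + 0
  Σcoeff-∉ []            w _   = refl
  Σcoeff-∉ ((a , v) ∷ p) w w∉ =
    cong₂ _+_ (select-no (v ≟ w) a (w∉ ∘ here ∘ sym)) (Σcoeff-∉ p w (w∉ ∘ there))

  fromCoeffs : (M → ℤ) → List M → Poly M
  fromCoeffs c []      = []
  fromCoeffs c (v ∷ L) with v ∈? L
  ... | yes _ = fromCoeffs c L
  ... | no  _ = (c v , v) ∷ fromCoeffs c L

  fromCoeffs-∉ : ∀ c L w → w ∉ L → Σcoeff (fromCoeffs c L) w ≡ + 0
  fromCoeffs-∉ c []      w _   = refl
  fromCoeffs-∉ c (v ∷ L) w w∉ with v ∈? L
  ... | yes _ = fromCoeffs-∉ c L w (w∉ ∘ there)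
  ... | no  _ = cong₂ _+_ (select-no (v ≟ w) (c v) (w∉ ∘ here ∘ sym)) (fromCoeffs-∉ c L w (w∉ ∘ there))

  fromCoeffs-∈ : ∀ c L w → w ∈ L → Σcoeff (fromCoeffs c L) w ≡ c w
  fromCoeffs-∈ c (v ∷ L) w w∈ with v ∈? L | w∈
  ... | yes v∈L | here refl = fromCoeffs-∈ c L w v∈L
  ... | yes _   | there w∈L = fromCoeffs-∈ c L w w∈L
  ... | no  v∉L | here refl =
    trans (cong₂ _+_ (select-yes (v ≟ v) (c v) refl) (fromCoeffs-∉ c L v v∉L)) (ℤP.+-identityʳ (c v))
  ... | no  v∉L | there w∈L =
    trans (cong₂ _+_ (select-no (v ≟ w) (c v) λ { refl → v∉L w∈L }) (fromCoeffs-∈ c L w w∈L)) (ℤP.+-identityˡ (c w))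


·ₘ-identityˡ : ∀ {k} (x : Vec ℕ k) → 𝟙 ·ₘ x ≡ x
·ₘ-identityˡ []      = refl
·ₘ-identityˡ (a ∷ x) = cong (a ∷_) (·ₘ-identityˡ x)

·ₘ-identityʳ : ∀ {k} (x : Vec ℕ k) → x ·ₘ 𝟙 ≡ x
·ₘ-identityʳ []      = refl
·ₘ-identityʳ (a ∷ x) = cong₂ _∷_ (ℕP.+-identityʳ a) (·ₘ-identityʳ x)

·ₘ-comm : ∀ {k} (x y : Vec ℕ k) → x ·ₘ y ≡ y ·ₘ x
·ₘ-comm []      []      = refl
·ₘ-comm (a ∷ x) (b ∷ y) = cong₂ _∷_ (ℕP.+-comm a b) (·ₘ-comm x y)

m·ₘn/ₘm≡n : ∀ {k} (x y : Vec ℕ k) → (x ·ₘ y) /ₘ x ≡ y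
m·ₘn/ₘm≡n []      []      = refl
m·ₘn/ₘm≡n (a ∷ x) (b ∷ y) = cong₂ _∷_ (ℕP.m+n∸m≡n a b) (m·ₘn/ₘm≡n x y)

m∣ₘn⇒n/ₘm·ₘm≡n : ∀ {k} {x y : Vec ℕ k} → x ∣ₘ y → (y /ₘ x) ·ₘ x ≡ y
m∣ₘn⇒n/ₘm·ₘm≡n []         = refl
m∣ₘn⇒n/ₘm·ₘm≡n (a≤b ∷ x∣y) = cong₂ _∷_ (ℕP.m∸n+n≡m a≤b) (m∣ₘn⇒n/ₘm·ₘm≡n x∣y)

m∣ₘm·ₘn : ∀ {k} (x y : Vec ℕ k) → x ∣ₘ (x ·ₘ y)
m∣ₘm·ₘn []      []      = []
m∣ₘm·ₘn (a ∷ x) (b ∷ y) = ℕP.m≤m+n a b ∷ m∣ₘm·ₘn x y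

_∣ₘ?_ : ∀ {k} (x y : Vec ℕ k) → Dec (x ∣ₘ y)
_∣ₘ?_ = Pointwise.decidable ℕP._≤?_

2^-mono-∣ : ∀ {i j} → i ≤ j → 2 ^ i ∣ 2 ^ j
2^-mono-∣ {i} {j} i≤j = divides (2 ^ (j ∸ i)) (begin
  2 ^ j               ≡⟨ cong (2 ^_) (sym (ℕP.m∸n+n≡m i≤j)) ⟩
  2 ^ (j ∸ i ℕ.+ i)     ≡⟨ ℕP.^-distribˡ-+-* 2 (j ∸ i) i ⟩
  2 ^ (j ∸ i) ℕ.* 2 ^ i ∎)
  where open ≡-Reasoning

maxPow2∣ : ℕ → ℕ → ℕ
maxPow2∣ a zero    = 0
maxPow2∣ a (suc j) with 2 ^ suc j ∣? a
... | yes _ = suc j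
... | no  _ = maxPow2∣ a j

2^maxPow2∣-∣ : ∀ a j → 2 ^ maxPow2∣ a j ∣ a
2^maxPow2∣-∣ a zero    = 1∣ a
2^maxPow2∣-∣ a (suc j) with 2 ^ suc j ∣? a
... | yes 2^j∣a = 2^j∣a
... | no  _     = 2^maxPow2∣-∣ a j

maxPow2∣-maximal : ∀ a {i} j → i ≤ j → 2 ^ i ∣ a → i ≤ maxPow2∣ a j
maxPow2∣-maximal a zero    i≤j _ = i≤j
maxPow2∣-maximal a (suc j) i≤j 2^i∣a with 2 ^ suc j ∣? a
... | yes _ = i≤j
... | no 2^j∤a with ℕP.m≤n⇒m<n∨m≡n i≤j
...   | inj₁ i<1+j = maxPow2∣-maximal a j (ℕP.≤-pred i<1+j) 2^i∣a
...   | inj₂ refl  = contradiction 2^i∣a 2^j∤a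

module OddInverse where

  open import Data.Nat using (_+_; _*_)
  open ℕ-Solver

  parity : ∀ t → ∃[ s ] (t ≡ 2 * s ⊎ t ≡ 1 + 2 * s)
  parity zero = 0 , inj₁ refl
  parity (suc t) with parity t
  ... | s , inj₁ e = s , inj₂ (cong suc e)
  ... | s , inj₂ e = suc s , inj₁ (trans (cong suc e) (solve 1 (λ s → con 2 :+ con 2 :* s := con 2 :* (con 1 :+ s)) refl s))

  -- Hensel lifting: if (1 + 2p) u = 1 + t 2^d with t odd, then u + 2^d works modulo 2^(d+1).
  odd-inverse-lift : ∀ d p → ∃₂ λ u t → (1 + 2 * p) * u ≡ 1 + t * 2 ^ d
  odd-inverse-lift zero    p = 1 , 2 * p , solve 1 (λ p → (con 1 :+ con 2 :* p) :* con 1 := con 1 :+ (con 2 :* p) :* con 1) refl p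
  odd-inverse-lift (suc d) p with odd-inverse-lift d p
  ... | u , t , e with parity t
  ...   | s , inj₁ refl = u , s , trans e (solve 2 (λ s D → con 1 :+ (con 2 :* s) :* D := con 1 :+ s :* (con 2 :* D)) refl s (2 ^ d))
  ...   | s , inj₂ refl = u + 2 ^ d , 1 + s + p , (begin
    (1 + 2 * p) * (u + 2 ^ d)                       ≡⟨ ℕP.*-distribˡ-+ (1 + 2 * p) u (2 ^ d) ⟩
    (1 + 2 * p) * u + (1 + 2 * p) * 2 ^ d           ≡⟨ cong (_+ (1 + 2 * p) * 2 ^ d) e ⟩
    1 + (1 + 2 * s) * 2 ^ d + (1 + 2 * p) * 2 ^ d
      ≡⟨ solve 3 (λ s p D → con 1 :+ (con 1 :+ con 2 :* s) :* D :+ (con 1 :+ con 2 :* p) :* D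
                         := con 1 :+ (con 1 :+ s :+ p) :* (con 2 :* D)) refl s p (2 ^ d) ⟩
    1 + (1 + s + p) * 2 ^ suc d                     ∎)
    where open ≡-Reasoning

  odd-invertible : ∀ d q → ¬ 2 ∣ q → ∃[ u ] (q * u) mod2^ d ≡ 1 mod2^ d
  odd-invertible d q 2∤q with parity q
  ... | s , inj₁ refl = contradiction (divides s (ℕP.*-comm 2 s)) 2∤q
  ... | p , inj₂ refl with odd-inverse-lift d p
  ...   | u , t , e = u , trans (cong (_mod2^ d) e) ([m+kn]%n≡m%n 1 t (2 ^ d) ⦃ m^n≢0 2 d ⦄)

open OddInverse using (odd-invertible)

module Valuation (d : ℕ) where

  open import Data.Nat using (_*_)

  instance
    2^d≢0 : NonZero (2 ^ d)
    2^d≢0 = m^n≢0 2 d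

  *-unit-mod : ∀ a {b} → b mod2^ d ≡ 1 mod2^ d → (a * b) mod2^ d ≡ a mod2^ d
  *-unit-mod a {b} b≡1 = begin
    (a * b) mod2^ d                        ≡⟨ %-distribˡ-* a b (2 ^ d) ⟩
    ((a mod2^ d) * (b mod2^ d)) mod2^ d    ≡⟨ cong (λ t → ((a mod2^ d) * t) mod2^ d) b≡1 ⟩
    ((a mod2^ d) * (1 mod2^ d)) mod2^ d    ≡⟨ sym (%-distribˡ-* a 1 (2 ^ d)) ⟩
    (a * 1) mod2^ d                        ≡⟨ cong (_mod2^ d) (ℕP.*-identityʳ a) ⟩
    a mod2^ d                              ∎
    where open ≡-Reasoning

  ∣ᵣ⇒∣ : ∀ {a} j → a ≢ 0 → _∣ᵣ_ d (2 ^ j) a → 2 ^ j ∣ a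
  ∣ᵣ⇒∣ {a} j a≢0 (c , e) with ℕP.≤-total j d
  ... | inj₁ j≤d = subst (2 ^ j ∣_) e (%-presˡ-∣ (m∣m*n c) (2^-mono-∣ j≤d))
  ... | inj₂ d≤j =
    contradiction (trans (sym e) (n∣m⇒m%n≡0 (2 ^ j * c) (2 ^ d) (∣m⇒∣m*n c (2^-mono-∣ d≤j)))) a≢0

  ∣⇒∣ᵣ : ∀ {a} j → a < 2 ^ d → 2 ^ j ∣ a → _∣ᵣ_ d (2 ^ j) a
  ∣⇒∣ᵣ {a} j a<2^d 2^j∣a =
    (a ℕ./ 2 ^ j) ⦃ m^n≢0 2 j ⦄ , trans (cong (_mod2^ d) (m*[n/m]≡n ⦃ m^n≢0 2 j ⦄ 2^j∣a)) (m<n⇒m%n≡m a<2^d)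

  2^j∣a⇒j≤d : ∀ {a} j → a < 2 ^ d → a ≢ 0 → 2 ^ j ∣ a → j ≤ d
  2^j∣a⇒j≤d {a} j a<2^d a≢0 2^j∣a = ℕP.≮⇒≥ λ d<j → ℕP.<-irrefl refl (ℕP.<-≤-trans a<2^d (begin
    2 ^ d ≤⟨ ℕP.^-monoʳ-≤ 2 (ℕP.<⇒≤ d<j) ⟩
    2 ^ j ≤⟨ ∣⇒≤ ⦃ ℕ.≢-nonZero a≢0 ⦄ 2^j∣a ⟩
    a     ∎))
    where open ℕP.≤-Reasoning

  2^j∣red[w*2^j] : ∀ w {j} → j ≤ d → 2 ^ j ∣ red d (w ℤ.* + 2 ^ j)
  2^j∣red[w*2^j] w {j} j≤d = subst (2 ^ j ∣_) (sym red[w*2^j]≡) (%-presˡ-∣ (n∣m*n (red d w)) (2^-mono-∣ j≤d))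
    where
    open Reduction d using (red-≡; *-congˡₘ; ≡ₘ-sym; red-≡ₘ)
    red[w*2^j]≡ : red d (w ℤ.* + 2 ^ j) ≡ (red d w * 2 ^ j) mod2^ d
    red[w*2^j]≡ = trans (red-≡ (*-congˡₘ (+ 2 ^ j) (≡ₘ-sym (red-≡ₘ w))))
                        (cong (red d) (sym (ℤP.pos-* (red d w) (2 ^ j))))

  ν₂ : ℕ → ℕ
  ν₂ a = maxPow2∣ a d

  ν₂-correct : ∀ {a} → a < 2 ^ d → a ≢ 0 → ν₂≡ d a (ν₂ a)
  ν₂-correct {a} a<2^d a≢0 = a≢0 , ∣⇒∣ᵣ (ν₂ a) a<2^d (2^maxPow2∣-∣ a d) , λ j 2^j∣ᵣa →
    let 2^j∣a = ∣ᵣ⇒∣ j a≢0 2^j∣ᵣa in maxPow2∣-maximal a d (2^j∣a⇒j≤d j a<2^d a≢0 2^j∣a) 2^j∣a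

  ν₂≡-unique : ∀ {a j j′} → ν₂≡ d a j → ν₂≡ d a j′ → j ≡ j′
  ν₂≡-unique (_ , 2^j∣a , max) (_ , 2^j′∣a , max′) = ℕP.≤-antisym (max′ _ 2^j∣a) (max _ 2^j′∣a)

  ν₂≡⇒∣ : ∀ {a k} → ν₂≡ d a k → 2 ^ k ∣ a
  ν₂≡⇒∣ {k = k} (a≢0 , 2^k∣ᵣa , _) = ∣ᵣ⇒∣ k a≢0 2^k∣ᵣa

  ν₂≡⇒≤d : ∀ {a k} → a < 2 ^ d → ν₂≡ d a k → k ≤ d
  ν₂≡⇒≤d {k = k} a<2^d v = 2^j∣a⇒j≤d k a<2^d (proj₁ v) (ν₂≡⇒∣ v)

  ν₂≡⇒odd-part : ∀ {a k} → a < 2 ^ d → ν₂≡ d a k → ¬ 2 ∣ a div2^ k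
  ν₂≡⇒odd-part {a} {k} a<2^d v@(_ , _ , max) 2∣a/2^k =
    ℕP.<-irrefl refl (max (suc k) (∣⇒∣ᵣ (suc k) a<2^d (m∣n/o⇒m*o∣n ⦃ m^n≢0 2 k ⦄ (ν₂≡⇒∣ v) 2∣a/2^k)))

  ν₂≡-split : ∀ {a k} → ν₂≡ d a k → a ≡ a div2^ k * 2 ^ k
  ν₂≡-split {k = k} v = sym (m/n*n≡m ⦃ m^n≢0 2 k ⦄ (ν₂≡⇒∣ v))

module _ {A : Set} {_≤_ : A → A → Set}
         (≤-refl : Reflexive _≤_) (≤-trans : Transitive _≤_) (≤-total : Total _≤_)
         {P : A → Set} (P? : ∀ y → Dec (P y)) where

  greatest-satisfying : ∀ L → (∀ y → y ∈ L → ¬ P y) ⊎ ∃[ b ] (b ∈ L × P b × ∀ y → y ∈ L → P y → y ≤ b)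
  greatest-satisfying []      = inj₁ λ _ ()
  greatest-satisfying (x ∷ L) with greatest-satisfying L | P? x
  ... | inj₁ none | no ¬Px = inj₁ λ { _ (here refl) → ¬Px ; y (there y∈L) → none y y∈L }
  ... | inj₁ none | yes Px =
    inj₂ (x , here refl , Px , λ { _ (here refl) _ → ≤-refl ; y (there y∈L) Py → contradiction Py (none y y∈L) })
  ... | inj₂ (b , b∈L , Pb , max) | no ¬Px =
    inj₂ (b , there b∈L , Pb , λ { _ (here refl) Px → contradiction Px ¬Px ; y (there y∈L) → max y y∈L })
  ... | inj₂ (b , b∈L , Pb , max) | yes Px with ≤-total x b
  ...   | inj₁ x≤b = inj₂ (b , there b∈L , Pb , λ { _ (here refl) _ → x≤b ; y (there y∈L) → max y y∈L })
  ...   | inj₂ b≤x =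
    inj₂ (x , here refl , Px , λ { _ (here refl) _ → ≤-refl ; y (there y∈L) Py → ≤-trans (max y y∈L Py) b≤x })

least-satisfying : ∀ {A : Set} (v : A → ℕ) {P : A → Set} → (∀ y → Dec (P y)) → ∀ L →
                   (∀ y → y ∈ L → ¬ P y) ⊎ ∃[ b ] (b ∈ L × P b × ∀ y → y ∈ L → P y → v b ≤ v y)
least-satisfying v = greatest-satisfying {_≤_ = λ a b → v b ≤ v a} ℕP.≤-refl (flip ℕP.≤-trans) (λ a b → ℕP.≤-total (v b) (v a))

module MonomialOrderProperties {n : ℕ} (O : MonomialOrder n) where

  open MonomialOrder O
  open IsStrictTotalOrder isStrictTotal using (compare; irrefl; asym) renaming (trans to ≺-trans)

  strictTotalOrder : StrictTotalOrder 0ℓ 0ℓ 0ℓ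
  strictTotalOrder = record { isStrictTotalOrder = isStrictTotal }

  open import Relation.Binary.Properties.StrictTotalOrder strictTotalOrder
    using () renaming (refl to ≼-refl; trans to ≼-trans; total to ≼-total) public

  Mon : Set
  Mon = Vec ℕ n

  ≼⇒⊁ : ∀ {p q} → p ≼ q → ¬ q ≺ p
  ≼⇒⊁ (inj₁ p≺q) q≺p = asym p≺q q≺p
  ≼⇒⊁ (inj₂ refl) p≺p = irrefl refl p≺p

  ·ₘ-monoˡ-≼ : ∀ {p q} r → p ≼ q → (p ·ₘ r) ≼ (q ·ₘ r)
  ·ₘ-monoˡ-≼ r (inj₁ p≺q) = inj₁ (mult-compat _ _ r p≺q)
  ·ₘ-monoˡ-≼ r (inj₂ refl) = inj₂ refl

  greatest : ∀ {P : Mon → Set} → (∀ y → Dec (P y)) → ∀ L →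
             (∀ y → y ∈ L → ¬ P y) ⊎ ∃[ b ] (b ∈ L × P b × ∀ y → y ∈ L → P y → y ≼ b)
  greatest = greatest-satisfying ≼-refl ≼-trans ≼-total

  Support : Set₁
  Support = Mon → Set

  Finite : Support → Set
  Finite S = ∃[ L ] (∀ y → S y → y ∈ L)

  -- The largest monomial on which S and S′ differ lies in S (the multiset order on finite supports).
  _⊏_ : Support → Support → Set
  S′ ⊏ S = Finite S′ × ∃[ m ] (S m × ¬ S′ m × ∀ y → m ≺ y → S′ y ⇔ S y)

  _─_ : Support → Mon → Support
  (S ─ a) y = S y × y ≢ a

  AccBoundedBy : Mon → Set₁
  AccBoundedBy a = ∀ S → Finite S → (∀ y → S y → y ≼ a) → Acc _⊏_ S

  acc-empty : ∀ S → (∀ y → ¬ S y) → Acc _⊏_ S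
  acc-empty S empty = acc λ (_ , m , Sm , _) → contradiction Sm (empty m)

  acc-strictly-below : ∀ a → (∀ {b} → b ≺ a → AccBoundedBy b) →
                       ∀ S → Finite S → (∀ y → S y → y ≺ a) → Acc _⊏_ S
  acc-strictly-below a ih S (L , S⊆L) below with greatest (_<? a) L
    where open IsStrictTotalOrder isStrictTotal using (_<?_)
  ... | inj₁ none = acc-empty S λ y Sy → none y (S⊆L y Sy) (below y Sy)
  ... | inj₂ (b , _ , b≺a , max) = ih b≺a S (L , S⊆L) λ y Sy → max y (S⊆L y Sy) (below y Sy)

  -- By induction on S ─ a: a descent from S either drops a, landing strictly below a,
  -- or happens below a and is then also a descent from S ─ a.
  acc-add-top : ∀ a → (∀ {b} → b ≺ a → AccBoundedBy b) →
                ∀ S → Acc _⊏_ (S ─ a) → (∀ y → S y → y ≼ a) → Acc _⊏_ S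
  acc-add-top a ih S (acc rs) S≼a = acc step
    where
    step : ∀ {S′} → S′ ⊏ S → Acc _⊏_ S′
    step {S′} (finS′ , m , Sm , ¬S′m , agree) with compare m a
    ... | tri> _ _ a≺m = contradiction a≺m (≼⇒⊁ (S≼a m Sm))
    ... | tri≈ _ refl _ = acc-strictly-below a ih S′ finS′ S′≺a
      where
      S′≺a : ∀ y → S′ y → y ≺ a
      S′≺a y S′y with compare y a
      ... | tri< y≺a _ _ = y≺a
      ... | tri≈ _ refl _ = contradiction S′y ¬S′m
      ... | tri> _ _ a≺y = contradiction a≺y (≼⇒⊁ (S≼a y (Equivalence.to (agree y a≺y) S′y)))
    ... | tri< m≺a _ _ = acc-add-top a ih S′ (rs S′─a⊏S─a) S′≼a
      where
      S′≼a : ∀ y → S′ y → y ≼ a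
      S′≼a y S′y with compare y a
      ... | tri< y≺a _ _ = inj₁ y≺a
      ... | tri≈ _ refl _ = inj₂ refl
      ... | tri> _ _ a≺y = contradiction a≺y (≼⇒⊁ (S≼a y (Equivalence.to (agree y (≺-trans m≺a a≺y)) S′y)))
      S′─a⊏S─a : (S′ ─ a) ⊏ (S ─ a)
      S′─a⊏S─a = (proj₁ finS′ , λ y → proj₂ finS′ y ∘ proj₁) , m , (Sm , λ m≡a → irrefl m≡a m≺a) ,
                 ¬S′m ∘ proj₁ , λ y m≺y → mk⇔ (map₁ (Equivalence.to (agree y m≺y))) (map₁ (Equivalence.from (agree y m≺y)))

  acc-bounded : ∀ a → Acc _≺_ a → AccBoundedBy a
  acc-bounded a (acc rs) S (L , S⊆L) S≼a =
    acc-add-top a ih S (acc-strictly-below a ih (S ─ a) (L , λ y → S⊆L y ∘ proj₁) S─a≺a) S≼a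
    where
    ih : ∀ {b} → b ≺ a → AccBoundedBy b
    ih b≺a = acc-bounded _ (rs b≺a)
    S─a≺a : ∀ y → (S ─ a) y → y ≺ a
    S─a≺a y (Sy , y≢a) with S≼a y Sy
    ... | inj₁ y≺a = y≺a
    ... | inj₂ y≡a = contradiction y≡a y≢a

  acc-finite : ∀ S → Finite S → Acc _⊏_ S
  acc-finite S (L , S⊆L) with greatest {λ _ → ⊤} (λ _ → yes tt) L
  ... | inj₁ none = acc-empty S λ y Sy → none y (S⊆L y Sy) tt
  ... | inj₂ (b , _ , _ , max) = acc-bounded b (well-ordered b) S (L , S⊆L) λ y Sy → max y (S⊆L y Sy) tt

  ⊏-wellFounded : WellFounded _⊏_
  ⊏-wellFounded S = acc λ S′⊏S → acc-finite _ (proj₁ S′⊏S)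

module Coefficients (d m n : ℕ) where

  open Polys d m n
  open Reduction d
  open import Data.Integer using (_+_; _*_; _-_; -_)
  open ℤ-Solver
  open CoefficientSum decLX using () renaming (Σcoeff to ΣLX; Σcoeff-++ to ΣLX-++; Σcoeff-∉ to ΣLX-∉) public
  open CoefficientSum decX  using () renaming (Σcoeff to ΣX; Σcoeff-∉ to ΣX-∉) public
  open CoefficientSum decΛ  using ()
    renaming (Σcoeff to ΣΛ; fromCoeffs to fromCoeffsΛ; fromCoeffs-∈ to fromCoeffsΛ-∈; fromCoeffs-∉ to fromCoeffsΛ-∉) public

  coeffLX≡red : ∀ f μ x → coeffLX f μ x ≡ red d (ΣLX f (μ , x))
  coeffLX≡red f μ x = CoefficientSum.coeff≡red-Σcoeff decLX d f (μ , x)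

  coeffX≡red : ∀ g x → coeffX g x ≡ red d (ΣX g x)
  coeffX≡red = CoefficientSum.coeff≡red-Σcoeff decX d

  coeffΛ≡red : ∀ C μ → coeffΛ C μ ≡ red d (ΣΛ C μ)
  coeffΛ≡red = CoefficientSum.coeff≡red-Σcoeff decΛ d

  Σcoeff≡ₘcoeff : ∀ {M} (_≟_ : DecidableEquality M) p w → CoefficientSum.Σcoeff _≟_ p w ≡ₘ + coeff d _≟_ p w
  Σcoeff≡ₘcoeff _≟_ p w = ≡ₘ-sym (≡ₘ-trans (≡⇒≡ₘ (cong +_ (CoefficientSum.coeff≡red-Σcoeff _≟_ d p w))) (red-≡ₘ _))

  coeffLX<N : ∀ f μ x → coeffLX f μ x < N
  coeffLX<N f μ x = subst (_< N) (sym (coeffLX≡red f μ x)) (red<N (ΣLX f (μ , x)))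

  coeffX<N : ∀ g x → coeffX g x < N
  coeffX<N g x = subst (_< N) (sym (coeffX≡red g x)) (red<N (ΣX g x))

  coeffLX≢0⇒∈ : ∀ f {μ x} → coeffLX f μ x ≢ 0 → (μ , x) ∈ map proj₂ f
  coeffLX≢0⇒∈ f {μ} {x} c≢0 with (μ , x) ∈? map proj₂ f
    where open import Data.List.Membership.DecPropositional decLX using (_∈?_)
  ... | yes w∈f = w∈f
  ... | no  w∉f = contradiction (trans (coeffLX≡red f μ x) (trans (cong (red d) (ΣLX-∉ f _ w∉f)) red-zero)) c≢0

  coeffX≢0⇒∈ : ∀ g {x} → coeffX g x ≢ 0 → x ∈ map proj₂ g
  coeffX≢0⇒∈ g {x} c≢0 with x ∈? map proj₂ g
    where open import Data.List.Membership.DecPropositional decX using (_∈?_)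
  ... | yes x∈g = x∈g
  ... | no  x∉g = contradiction (trans (coeffX≡red g x) (trans (cong (red d) (ΣX-∉ g x x∉g)) red-zero)) c≢0

  ΣLX-neg : ∀ p w → ΣLX (-ₚ p) w ≡ - ΣLX p w
  ΣLX-neg []            w = refl
  ΣLX-neg ((a , v) ∷ p) w =
    trans (cong₂ _+_ (select-neg (decLX v w) a) (ΣLX-neg p w)) (sym (ℤP.neg-distrib-+ (select (decLX v w) a) (ΣLX p w)))

  coeffLX-ₚ : ∀ f g μ x → coeffLX (f -ₚ g) μ x ≡ red d (ΣLX f (μ , x) - ΣLX g (μ , x))
  coeffLX-ₚ f g μ x = trans (coeffLX≡red (f -ₚ g) μ x)
    (cong (red d) (trans (ΣLX-++ f (-ₚ g) (μ , x)) (cong (_+_ (ΣLX f (μ , x))) (ΣLX-neg g (μ , x)))))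

  ΣLX-*ₚ-∷ : ∀ t p q w → ΣLX ((t ∷ p) *ₚ q) w ≡ ΣLX ([ t ] *ₚ q) w + ΣLX (p *ₚ q) w
  ΣLX-*ₚ-∷ t p q w = trans (cong (λ l → ΣLX l w) *ₚ-∷) (ΣLX-++ ([ t ] *ₚ q) (p *ₚ q) w)
    where
    *ₚ-∷ : (t ∷ p) *ₚ q ≡ ([ t ] *ₚ q) ++ (p *ₚ q)
    *ₚ-∷ = cong (_++ (p *ₚ q)) (sym (++-identityʳ _))

  select-pair : ∀ {ν μ : Vec ℕ m} {z y : Vec ℕ n} c b →
                select (decLX (ν , z) (μ , y)) (c * b) ≡ select (decΛ ν μ) c * select (decX z y) b
  select-pair {ν} {μ} {z} {y} c b = by-cases (decΛ ν μ) (decX z y)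
    where
    D : Dec ((ν , z) ≡ (μ , y))
    D = decLX (ν , z) (μ , y)
    by-cases : Dec (ν ≡ μ) → Dec (z ≡ y) → select D (c * b) ≡ select (decΛ ν μ) c * select (decX z y) b
    by-cases (yes ν≡μ) (yes z≡y) = trans (select-yes D (c * b) (cong₂ _,_ ν≡μ z≡y))
      (sym (cong₂ _*_ (select-yes (decΛ ν μ) c ν≡μ) (select-yes (decX z y) b z≡y)))
    by-cases (yes _) (no z≢y) = trans (select-no D (c * b) (z≢y ∘ cong proj₂))
      (sym (trans (cong (select (decΛ ν μ) c *_) (select-no (decX z y) b z≢y)) (ℤP.*-zeroʳ (select (decΛ ν μ) c))))
    by-cases (no ν≢μ) _ = trans (select-no D (c * b) (ν≢μ ∘ cong proj₁))
      (sym (trans (cong (_* select (decX z y) b) (select-no (decΛ ν μ) c ν≢μ)) (ℤP.*-zeroˡ (select (decX z y) b))))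

  select-·ₘ𝟙 : ∀ (ν μ : Vec ℕ m) c → select (decΛ (ν ·ₘ 𝟙) μ) c ≡ select (decΛ ν μ) c
  select-·ₘ𝟙 ν μ c = select-cong (decΛ (ν ·ₘ 𝟙) μ) (decΛ ν μ) c (mk⇔ (trans (sym (·ₘ-identityʳ ν))) (trans (·ₘ-identityʳ ν)))

  shiftX : Vec ℕ n → PolyX → PolyX
  shiftX r = map (map₂ (r ·ₘ_))

  ΣX-shiftX-≡ : ∀ {r z₀ y} g → r ·ₘ z₀ ≡ y → ΣX (shiftX r g) y ≡ ΣX g z₀
  ΣX-shiftX-≡ []            _ = refl
  ΣX-shiftX-≡ {r} {z₀} {y} ((b , z) ∷ g) r·z₀≡y = cong₂ _+_
    (select-cong (decX (r ·ₘ z) y) (decX z z₀) b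
       (mk⇔ (λ r·z≡y → ·ₘ-cancelˡ (trans r·z≡y (sym r·z₀≡y))) (λ z≡z₀ → trans (cong (r ·ₘ_) z≡z₀) r·z₀≡y)))
    (ΣX-shiftX-≡ g r·z₀≡y)
    where
    ·ₘ-cancelˡ : ∀ {z z′} → r ·ₘ z ≡ r ·ₘ z′ → z ≡ z′
    ·ₘ-cancelˡ {z} {z′} e = trans (sym (m·ₘn/ₘm≡n r z)) (trans (cong (_/ₘ r) e) (m·ₘn/ₘm≡n r z′))

  ΣX-shiftX-∤ : ∀ {r y} g → ¬ r ∣ₘ y → ΣX (shiftX r g) y ≡ + 0
  ΣX-shiftX-∤ []            _ = refl
  ΣX-shiftX-∤ {r} {y} ((b , z) ∷ g) r∤y =
    cong₂ _+_ (select-no (decX (r ·ₘ z) y) b λ r·z≡y → r∤y (subst (r ∣ₘ_) r·z≡y (m∣ₘm·ₘn r z))) (ΣX-shiftX-∤ g r∤y)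

  ΣLX-term*ₚembX : ∀ c (ν : Vec ℕ m) x g μ y →
                   ΣLX ([ (c , (ν , x)) ] *ₚ embX g) (μ , y) ≡ select (decΛ ν μ) c * ΣX (shiftX x g) y
  ΣLX-term*ₚembX c ν x []            μ y = sym (ℤP.*-zeroʳ (select (decΛ ν μ) c))
  ΣLX-term*ₚembX c ν x ((b , z) ∷ g) μ y = begin
    select (decLX (ν ·ₘ 𝟙 , x ·ₘ z) (μ , y)) (c * b) + ΣLX ([ (c , (ν , x)) ] *ₚ embX g) (μ , y)
      ≡⟨ cong₂ _+_ (select-pair {ν ·ₘ 𝟙} {μ} {x ·ₘ z} {y} c b) (ΣLX-term*ₚembX c ν x g μ y) ⟩
    select (decΛ (ν ·ₘ 𝟙) μ) c * select (decX (x ·ₘ z) y) b + select (decΛ ν μ) c * ΣX (shiftX x g) y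
      ≡⟨ cong (λ s → s * select (decX (x ·ₘ z) y) b + select (decΛ ν μ) c * ΣX (shiftX x g) y) (select-·ₘ𝟙 ν μ c) ⟩
    select (decΛ ν μ) c * select (decX (x ·ₘ z) y) b + select (decΛ ν μ) c * ΣX (shiftX x g) y
      ≡⟨ sym (ℤP.*-distribˡ-+ (select (decΛ ν μ) c) (select (decX (x ·ₘ z) y) b) (ΣX (shiftX x g) y)) ⟩
    select (decΛ ν μ) c * ΣX (shiftX x ((b , z) ∷ g)) y ∎
    where open ≡-Reasoning

  ΣLX-reductor : ∀ C u r g μ y →
                 ΣLX ((embΛ C *ₚ termX u r) *ₚ embX g) (μ , y) ≡ ΣΛ C μ * + u * ΣX (shiftX r g) y
  ΣLX-reductor []             u r g μ y =
    sym (trans (cong (_* ΣX (shiftX r g) y) (ℤP.*-zeroˡ (+ u))) (ℤP.*-zeroˡ (ΣX (shiftX r g) y)))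
  ΣLX-reductor ((a , ν) ∷ C) u r g μ y = begin
    ΣLX ((embΛ ((a , ν) ∷ C) *ₚ termX u r) *ₚ embX g) (μ , y)
      ≡⟨ ΣLX-*ₚ-∷ (a * + u , (ν ·ₘ 𝟙 , 𝟙 ·ₘ r)) (embΛ C *ₚ termX u r) (embX g) (μ , y) ⟩
    ΣLX ([ (a * + u , (ν ·ₘ 𝟙 , 𝟙 ·ₘ r)) ] *ₚ embX g) (μ , y) + ΣLX ((embΛ C *ₚ termX u r) *ₚ embX g) (μ , y)
      ≡⟨ cong₂ _+_ (ΣLX-term*ₚembX (a * + u) (ν ·ₘ 𝟙) (𝟙 ·ₘ r) g μ y) (ΣLX-reductor C u r g μ y) ⟩
    select (decΛ (ν ·ₘ 𝟙) μ) (a * + u) * ΣX (shiftX (𝟙 ·ₘ r) g) y + ΣΛ C μ * + u * ΣX (shiftX r g) y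
      ≡⟨ cong₂ (λ s r′ → s * ΣX (shiftX r′ g) y + ΣΛ C μ * + u * ΣX (shiftX r g) y) select-νu (·ₘ-identityˡ r) ⟩
    select (decΛ ν μ) a * + u * ΣX (shiftX r g) y + ΣΛ C μ * + u * ΣX (shiftX r g) y
      ≡⟨ solve 4 (λ s t v w → s :* v :* w :+ t :* v :* w := (s :+ t) :* v :* w) refl
                 (select (decΛ ν μ) a) (ΣΛ C μ) (+ u) (ΣX (shiftX r g) y) ⟩
    ΣΛ ((a , ν) ∷ C) μ * + u * ΣX (shiftX r g) y ∎
    where
    open ≡-Reasoning
    select-νu : select (decΛ (ν ·ₘ 𝟙) μ) (a * + u) ≡ select (decΛ ν μ) a * + u
    select-νu = trans (select-·ₘ𝟙 ν μ (a * + u)) (select-*ʳ (decΛ ν μ) a (+ u))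

  ΣLX-*ₚtermX-multiple : ∀ h a x μ y → ∃[ z ] ΣLX (h *ₚ termX a x) (μ , y) ≡ z * + a
  ΣLX-*ₚtermX-multiple []                  a x μ y = + 0 , sym (ℤP.*-zeroˡ (+ a))
  ΣLX-*ₚtermX-multiple ((b , (ν , e)) ∷ h) a x μ y with ΣLX-*ₚtermX-multiple h a x μ y
  ... | z , eq = select D b + z , (begin
    select D (b * + a) + ΣLX (h *ₚ termX a x) (μ , y) ≡⟨ cong₂ _+_ (select-*ʳ D b (+ a)) eq ⟩
    select D b * + a + z * + a                       ≡⟨ sym (ℤP.*-distribʳ-+ (+ a) (select D b) z) ⟩
    (select D b + z) * + a                           ∎)
    where
    open ≡-Reasoning
    D : Dec ((ν ·ₘ 𝟙 , e ·ₘ x) ≡ (μ , y))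
    D = decLX (ν ·ₘ 𝟙 , e ·ₘ x) (μ , y)

  ΣLX-*ₚtermX-∤ : ∀ h a x μ y → ¬ x ∣ₘ y → ΣLX (h *ₚ termX a x) (μ , y) ≡ + 0
  ΣLX-*ₚtermX-∤ []                  a x μ y x∤y = refl
  ΣLX-*ₚtermX-∤ ((b , (ν , e)) ∷ h) a x μ y x∤y = cong₂ _+_
    (select-no (decLX (ν ·ₘ 𝟙 , e ·ₘ x) (μ , y)) (b * + a)
      λ e·x≡y → x∤y (subst (x ∣ₘ_) (trans (·ₘ-comm x e) (cong proj₂ e·x≡y)) (m∣ₘm·ₘn x e)))
    (ΣLX-*ₚtermX-∤ h a x μ y x∤y)

module NormalForm (d m n : ℕ) (O : MonomialOrder n) (G : List (Polys.PolyX d m n)) where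

  open Polys d m n
  open WithOrder O
  open Procedure G
  open MonomialOrder O
  open MonomialOrderProperties O
  open Coefficients d m n
  open Reduction d
  open Valuation d
  open import Data.Integer using (_+_; _*_; _-_; -_)

  Λs : PolyLX → List (Vec ℕ m)
  Λs f = map proj₁ (map proj₂ f)

  Xs : PolyLX → List (Vec ℕ n)
  Xs f = map proj₂ (map proj₂ f)

  coeffLX≢0⇒∈Λs : ∀ f {μ x} → coeffLX f μ x ≢ 0 → μ ∈ Λs f
  coeffLX≢0⇒∈Λs f c≢0 = ∈-map⁺ proj₁ (coeffLX≢0⇒∈ f c≢0)

  occurs⇒∈Xs : ∀ f {x} → OccursLX f x → x ∈ Xs f
  occurs⇒∈Xs f (_ , c≢0) = ∈-map⁺ proj₂ (coeffLX≢0⇒∈ f c≢0)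

  coeffLX≢0? : ∀ f x μ → Dec (coeffLX f μ x ≢ 0)
  coeffLX≢0? f x μ = ¬? (coeffLX f μ x ℕ.≟ 0)

  occurs? : ∀ f x → Dec (OccursLX f x)
  occurs? f x with any? (coeffLX≢0? f x) (Λs f)
  ... | yes found = let μ , _ , c≢0 = find found in yes (μ , c≢0)
  ... | no  none  = no λ (μ , c≢0) → none (lose (coeffLX≢0⇒∈Λs f c≢0) c≢0)

  ν̄₂-exists : ∀ f {x} → OccursLX f x → ∃[ k ] ν̄₂≡ d (coeffL f x) k
  ν̄₂-exists f {x} (μ₀ , c≢0) with least-satisfying (λ μ → ν₂ (coeffLX f μ x)) (coeffLX≢0? f x) (Λs f)
  ... | inj₁ none = contradiction c≢0 (none μ₀ (coeffLX≢0⇒∈Λs f c≢0))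
  ... | inj₂ (μ , _ , cμ≢0 , min) = ν₂ (coeffLX f μ x) , (μ , ν₂-correct (coeffLX<N f μ x) cμ≢0) , λ ν j ν₂≡j →
    let cν≢0 = proj₁ ν₂≡j in
    subst (ν₂ (coeffLX f μ x) ℕ.≤_) (ν₂≡-unique (ν₂-correct (coeffLX<N f ν x) cν≢0) ν₂≡j)
          (min ν (coeffLX≢0⇒∈Λs f cν≢0) cν≢0)

  ν̄₂≡-unique : ∀ {c : Vec ℕ m → ℕ} {k k′} → ν̄₂≡ d c k → ν̄₂≡ d c k′ → k ≡ k′
  ν̄₂≡-unique ((μ , ν₂≡k) , min) ((μ′ , ν₂≡k′) , min′) = ℕP.≤-antisym (min μ′ _ ν₂≡k′) (min′ μ _ ν₂≡k)

  lm-or-zero : ∀ g → (∃[ x ] IsLMX g x) ⊎ (∀ x → coeffX g x ≡ 0)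
  lm-or-zero g with greatest (λ x → ¬? (coeffX g x ℕ.≟ 0)) (map proj₂ g)
  ... | inj₁ none = inj₂ λ x → decidable-stable (coeffX g x ℕ.≟ 0) λ c≢0 → none x (coeffX≢0⇒∈ g c≢0) c≢0
  ... | inj₂ (x , _ , c≢0 , max) = inj₁ (x , c≢0 , λ y cy≢0 → max y (coeffX≢0⇒∈ g cy≢0) cy≢0)

  IsLMX-unique : ∀ {g x x′} → IsLMX g x → IsLMX g x′ → x ≡ x′
  IsLMX-unique (c≢0 , max) (c′≢0 , max′) with max _ c′≢0
  ... | inj₂ x′≡x  = sym x′≡x
  ... | inj₁ x′≺x = contradiction x′≺x (≼⇒⊁ (max′ _ c≢0))

  module _ (f : PolyLX) where

    Reducible : Vec ℕ n → ℕ → Vec ℕ n → Set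
    Reducible x k mt = OccursLX f mt × x ∣ₘ mt × ∃[ k̄ ] (ν̄₂≡ d (coeffL f mt) k̄ × k ℕ.≤ k̄)

    reducible? : ∀ x k mt → Dec (Reducible x k mt)
    reducible? x k mt with occurs? f mt
    ... | no ¬occ = no (¬occ ∘ proj₁)
    ... | yes occ with x ∣ₘ? mt | ν̄₂-exists f occ
    ...   | no x∤mt | _ = no (x∤mt ∘ proj₁ ∘ proj₂)
    ...   | yes x∣mt | k̄ , ν̄₂≡k̄ with k ℕ.≤? k̄
    ...     | yes k≤k̄ = yes (occ , x∣mt , k̄ , ν̄₂≡k̄ , k≤k̄)
    ...     | no  k≰k̄ = no λ (_ , _ , k̄′ , ν̄₂≡k̄′ , k≤k̄′) →
      k≰k̄ (subst (k ℕ.≤_) (ν̄₂≡-unique ν̄₂≡k̄′ ν̄₂≡k̄) k≤k̄′)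

    redex-by : ∀ g → g ∈ G → Redex f ⊎ (∀ (r : Redex f) → Redex.g r ≢ g)
    redex-by g g∈G with lm-or-zero g
    ... | inj₂ g≡0 = inj₂ λ r g′≡g →
      proj₁ (Redex.isLM r) (subst (λ h → coeffX h (Redex.lmg r) ≡ 0) (sym g′≡g) (g≡0 (Redex.lmg r)))
    ... | inj₁ (x , isLM) with any? (reducible? x (ν₂ (coeffX g x))) (Xs f)
    ...   | yes found = let mt , _ , (occ , x∣mt , k̄ , ν̄₂≡k̄ , k≤k̄) = find found in
      inj₁ (record { g = g ; g∈G = g∈G ; lmg = x ; isLM = isLM ; mt = mt ; occurs = occ ; divides = x∣mt
                   ; k = ν₂ (coeffX g x) ; νk = ν₂-correct (coeffX<N g x) (proj₁ isLM)
                   ; kbar = k̄ ; νbar = ν̄₂≡k̄ ; k≤kbar = k≤k̄ })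
    ...   | no none = inj₂ no-redex
      where
      no-redex : ∀ (r : Redex f) → Redex.g r ≢ g
      no-redex r g′≡g = none (lose (occurs⇒∈Xs f occurs)
        (occurs , subst (_∣ₘ mt) lmg≡x lmg∣mt , kbar , νbar , subst (ℕ._≤ kbar) k≡ν₂ k≤kbar))
        where
        open Redex r using (lmg; mt; occurs; νk; kbar; νbar; k≤kbar) renaming (k to k′; divides to lmg∣mt)
        lmg≡x : lmg ≡ x
        lmg≡x = IsLMX-unique {g} (subst (λ h → IsLMX h lmg) g′≡g (Redex.isLM r)) isLM
        k≡ν₂ : k′ ≡ ν₂ (coeffX g x)
        k≡ν₂ = ν₂≡-unique (subst₂ (λ h y → ν₂≡ d (coeffX h y) k′) g′≡g lmg≡x νk)
                          (ν₂-correct (coeffX<N g x) (proj₁ isLM))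

    redex-among : ∀ gs → (∀ {g} → g ∈ gs → g ∈ G) → Redex f ⊎ (∀ (r : Redex f) → Redex.g r ∉ gs)
    redex-among []       _     = inj₂ λ _ ()
    redex-among (g ∷ gs) gs⊆G with redex-by g (gs⊆G (here refl)) | redex-among gs (gs⊆G ∘ there)
    ... | inj₁ r     | _          = inj₁ r
    ... | inj₂ _     | inj₁ r     = inj₁ r
    ... | inj₂ none₁ | inj₂ none₂ =
      inj₂ λ { r (here g′≡g) → none₁ r g′≡g ; r (there g′∈gs) → none₂ r g′∈gs }

    redex? : Redex f ⊎ Irreducible f
    redex? with redex-among G id
    ... | inj₁ r    = inj₁ r
    ... | inj₂ none = inj₂ λ r → none r (Redex.g∈G r)

  module ReductionStep {f : PolyLX} (r : Redex f) where

    open Redex r renaming (divides to lmg∣mt)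

    2^k∣coeff : ∀ μ → 2 ^ k ∣ coeffLX f μ mt
    2^k∣coeff μ with coeffLX f μ mt ℕ.≟ 0
    ... | yes c≡0 = subst (2 ^ k ∣_) (sym c≡0) ((2 ^ k) ∣0)
    ... | no  c≢0 = ∣-trans (2^-mono-∣ (ℕP.≤-trans k≤kbar (proj₂ νbar μ _ ν₂c))) (ν₂≡⇒∣ ν₂c)
      where
      ν₂c : ν₂≡ d (coeffLX f μ mt) (ν₂ (coeffLX f μ mt))
      ν₂c = ν₂-correct (coeffLX<N f μ mt) c≢0

    div2^k-regroup : ∀ u μ → let c = coeffLX f μ mt ; lc = coeffX g lmg in
              c div2^ k ℕ.* u ℕ.* lc ≡ c ℕ.* (lc div2^ k ℕ.* u)
    div2^k-regroup u μ = begin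
      q ℕ.* u ℕ.* lc               ≡⟨ cong (q ℕ.* u ℕ.*_) (ν₂≡-split νk) ⟩
      q ℕ.* u ℕ.* (ql ℕ.* 2 ^ k)   ≡⟨ solve 4 (λ q u ql K → q :* u :* (ql :* K) := (q :* K) :* (ql :* u)) refl q u ql (2 ^ k) ⟩
      q ℕ.* 2 ^ k ℕ.* (ql ℕ.* u)   ≡⟨ cong (ℕ._* (ql ℕ.* u)) (m/n*n≡m ⦃ m^n≢0 2 k ⦄ (2^k∣coeff μ)) ⟩
      c ℕ.* (ql ℕ.* u)             ∎
      where
      open ≡-Reasoning
      open ℕ-Solver
      c q lc ql : ℕ
      c  = coeffLX f μ mt
      q  = c div2^ k
      lc = coeffX g lmg
      ql = lc div2^ k

    ΣX-shift-at-mt : ΣX (shiftX (mt /ₘ lmg) g) mt ≡ ΣX g lmg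
    ΣX-shift-at-mt = ΣX-shiftX-≡ g (m∣ₘn⇒n/ₘm·ₘm≡n lmg∣mt)

    ΣX-shift-above : ∀ {y} → mt ≺ y → ΣX (shiftX (mt /ₘ lmg) g) y ≡ₘ + 0
    ΣX-shift-above {y} mt≺y with (mt /ₘ lmg) ∣ₘ? y
    ... | no  ∤y = ≡⇒≡ₘ (ΣX-shiftX-∤ g ∤y)
    ... | yes ∣y = mk≡ₘ (begin
      red d (ΣX (shiftX q g) y) ≡⟨ cong (red d) (ΣX-shiftX-≡ g (trans (·ₘ-comm q z) (m∣ₘn⇒n/ₘm·ₘm≡n ∣y))) ⟩
      red d (ΣX g z)            ≡⟨ sym (coeffX≡red g z) ⟩
      coeffX g z                ≡⟨ decidable-stable (coeffX g z ℕ.≟ 0) z-absent ⟩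
      0                         ≡⟨ sym red-zero ⟩
      red d (+ 0)               ∎)
      where
      open ≡-Reasoning
      q z : Vec ℕ n
      q = mt /ₘ lmg
      z = y /ₘ q
      z-absent : coeffX g z ≢ 0 → ⊥
      z-absent c≢0 = ≼⇒⊁ (subst₂ _≼_ (m∣ₘn⇒n/ₘm·ₘm≡n ∣y) (trans (·ₘ-comm lmg q) (m∣ₘn⇒n/ₘm·ₘm≡n lmg∣mt))
                                  (·ₘ-monoˡ-≼ q (proj₂ isLM z c≢0)))
                         mt≺y

    module _ (C : PolyΛ) (u : ℕ) where

      reductor : PolyLX
      reductor = (embΛ C *ₚ termX u (mt /ₘ lmg)) *ₚ embX g

      reductor-above : ∀ {μ y} → mt ≺ y → ΣLX reductor (μ , y) ≡ₘ + 0
      reductor-above {μ} {y} mt≺y = begin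
        ΣLX reductor (μ , y)                         ≡⟨ ΣLX-reductor C u (mt /ₘ lmg) g μ y ⟩
        ΣΛ C μ * + u * ΣX (shiftX (mt /ₘ lmg) g) y   ≈⟨ *-congʳₘ (ΣΛ C μ * + u) (ΣX-shift-above mt≺y) ⟩
        ΣΛ C μ * + u * + 0                           ≡⟨ ℤP.*-zeroʳ (ΣΛ C μ * + u) ⟩
        + 0                                          ∎
        where open ≡ₘ-Reasoning

      coeff-above : ∀ {f′ μ y} → f′ ≈ (f -ₚ reductor) → mt ≺ y → coeffLX f′ μ y ≡ coeffLX f μ y
      coeff-above {f′} {μ} {y} f′≈ mt≺y = begin
        coeffLX f′ μ y                                  ≡⟨ f′≈ μ y ⟩
        coeffLX (f -ₚ reductor) μ y                     ≡⟨ coeffLX-ₚ f reductor μ y ⟩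
        red d (ΣLX f (μ , y) - ΣLX reductor (μ , y))   ≡⟨ red-≡ (+-congʳₘ (ΣLX f (μ , y)) (neg-congₘ (reductor-above mt≺y))) ⟩
        red d (ΣLX f (μ , y) + + 0)                    ≡⟨ cong (red d) (ℤP.+-identityʳ (ΣLX f (μ , y))) ⟩
        red d (ΣLX f (μ , y))                          ≡⟨ sym (coeffLX≡red f μ y) ⟩
        coeffLX f μ y                                  ∎
        where open ≡-Reasoning

      module _ (Cspec : ∀ μ → coeffΛ C μ ≡ coeffL f mt μ div2^ k)
               (uspec : (coeffX g lmg div2^ k ℕ.* u) mod2^ d ≡ 1 mod2^ d) where

        -- (c / 2^k) · (lc / 2^k)⁻¹ · lc = c · ((lc / 2^k) · (lc / 2^k)⁻¹) = c, using 2^k ∣ c.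
        reductor-at-mt : ∀ μ → ΣLX reductor (μ , mt) ≡ₘ + coeffLX f μ mt
        reductor-at-mt μ = begin
          ΣLX reductor (μ , mt)                         ≡⟨ ΣLX-reductor C u (mt /ₘ lmg) g μ mt ⟩
          ΣΛ C μ * + u * ΣX (shiftX (mt /ₘ lmg) g) mt   ≡⟨ cong (λ t → ΣΛ C μ * + u * t) ΣX-shift-at-mt ⟩
          ΣΛ C μ * + u * ΣX g lmg                       ≈⟨ *-congₘ (*-congˡₘ (+ u) C≡ₘq) (Σcoeff≡ₘcoeff decX g lmg) ⟩
          + q * + u * + lc                              ≡⟨ trans (cong (_* + lc) (sym (ℤP.pos-* q u))) (sym (ℤP.pos-* (q ℕ.* u) lc)) ⟩
          + (q ℕ.* u ℕ.* lc)                            ≈⟨ mk≡ₘ (trans (cong (_mod2^ d) (div2^k-regroup u μ)) (*-unit-mod c uspec)) ⟩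
          + c                                           ∎
          where
          open ≡ₘ-Reasoning
          c q lc : ℕ
          c  = coeffLX f μ mt
          q  = c div2^ k
          lc = coeffX g lmg
          C≡ₘq : ΣΛ C μ ≡ₘ + q
          C≡ₘq = ≡ₘ-trans (Σcoeff≡ₘcoeff decΛ C μ) (≡⇒≡ₘ (cong +_ (Cspec μ)))

        coeff-at-mt : ∀ {f′} → f′ ≈ (f -ₚ reductor) → ∀ μ → coeffLX f′ μ mt ≡ 0
        coeff-at-mt {f′} f′≈ μ = begin
          coeffLX f′ μ mt                                 ≡⟨ f′≈ μ mt ⟩
          coeffLX (f -ₚ reductor) μ mt                    ≡⟨ coeffLX-ₚ f reductor μ mt ⟩
          red d (ΣLX f (μ , mt) - ΣLX reductor (μ , mt))  ≡⟨ red-≡ (+-congₘ (Σcoeff≡ₘcoeff decLX f (μ , mt)) (neg-congₘ (reductor-at-mt μ))) ⟩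
          red d (+ c - + c)                               ≡⟨ cong (red d) (ℤP.+-inverseʳ (+ c)) ⟩
          red d (+ 0)                                     ≡⟨ red-zero ⟩
          0                                               ∎
          where
          open ≡-Reasoning
          c : ℕ
          c = coeffLX f μ mt

  step⇒⊏ : ∀ {f f′} → Step f f′ → OccursLX f′ ⊏ OccursLX f
  step⇒⊏ {f} {f′} (r , C , Cspec , u , uspec , f′≈) =
    (Xs f′ , λ _ → occurs⇒∈Xs f′) , mt , occurs , (λ (μ , c≢0) → c≢0 (coeff-at-mt C u Cspec uspec {f′} f′≈ μ)) ,
    λ y mt≺y → mk⇔ (λ (μ , c≢0) → μ , c≢0 ∘ trans (coeff-above C u {f′} f′≈ mt≺y))
                    (λ (μ , c≢0) → μ , c≢0 ∘ trans (sym (coeff-above C u {f′} f′≈ mt≺y)))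
    where
    open Redex r using (mt; occurs)
    open ReductionStep r

  step-wellFounded : WellFounded (λ f′ f → Step f f′)
  step-wellFounded = Subrelation.wellFounded {_<₁_ = λ f′ f → Step f f′} {_<₂_ = _⊏_ on OccursLX}
                                             (λ {f′} {f} → step⇒⊏ {f} {f′}) (On.wellFounded OccursLX ⊏-wellFounded)

  step-exists : ∀ {f} → Redex f → ∃[ f′ ] Step f f′
  step-exists {f} r = f -ₚ reductor C (proj₁ inverse) , r , C , C-spec , proj₁ inverse , proj₂ inverse , λ _ _ → refl
    where
    open Redex r
    open ReductionStep r using (reductor)
    open import Data.List.Membership.DecPropositional decΛ using (_∈?_)
    q : Vec ℕ m → ℕ
    q μ = coeffLX f μ mt div2^ k
    C : PolyΛ
    C = fromCoeffsΛ (+_ ∘ q) (Λs f)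
    C-spec : ∀ μ → coeffΛ C μ ≡ q μ
    C-spec μ with μ ∈? Λs f
    ... | yes μ∈ = trans (coeffΛ≡red C μ) (trans (cong (red d) (fromCoeffsΛ-∈ (+_ ∘ q) (Λs f) μ μ∈)) (red-small q<N))
      where
      q<N : q μ < N
      q<N = ℕP.≤-<-trans (m/n≤m _ (2 ^ k) ⦃ m^n≢0 2 k ⦄) (coeffLX<N f μ mt)
    ... | no  μ∉ = trans (coeffΛ≡red C μ) (trans (cong (red d) (fromCoeffsΛ-∉ (+_ ∘ q) (Λs f) μ μ∉))
                                                 (trans red-zero (sym (trans (cong (_div2^ k) c≡0) (0/n≡0 (2 ^ k) ⦃ m^n≢0 2 k ⦄)))))
      where
      c≡0 : coeffLX f μ mt ≡ 0
      c≡0 = decidable-stable (coeffLX f μ mt ℕ.≟ 0) (μ∉ ∘ coeffLX≢0⇒∈Λs f)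
    inverse : ∃[ u ] (coeffX g lmg div2^ k ℕ.* u) mod2^ d ≡ 1 mod2^ d
    inverse = odd-invertible d _ (ν₂≡⇒odd-part (coeffX<N g lmg) νk)

  normal-form : ∀ f → Acc (λ f′ f → Step f f′) f → ∃[ f′ ] (Star Step f f′ × Irreducible f′)
  normal-form f (acc rs) with redex? f
  ... | inj₂ irreducible = f , ε , irreducible
  ... | inj₁ r = let f₁ , s = step-exists r ; f′ , s* , irreducible = normal-form f₁ (rs s) in f′ , s ◅ s* , irreducible

  zero-irreducible : ∀ {f} → f ≈ 0ₚ → Irreducible f
  zero-irreducible f≈0 r = proj₂ occurs (trans (f≈0 (proj₁ occurs) mt) red-zero)
    where open Redex r

  zero-normal-form : ∀ {f f′} → f ≈ 0ₚ → Star Step f f′ → f′ ≈ 0ₚ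
  zero-normal-form f≈0 ε       = f≈0
  zero-normal-form f≈0 (s ◅ _) = contradiction (proj₁ s) (zero-irreducible f≈0)

  reduction-in-ideal : ∀ {f f′} → Star Step f f′ → InIdeal (f -ₚ f′) G
  reduction-in-ideal {f} ε = [] , [] , λ μ x → trans (coeffLX-ₚ f f μ x) (cong (red d) (ℤP.+-inverseʳ (ΣLX f (μ , x))))
  reduction-in-ideal {f} {f′} (_◅_ {j = f₁} (r , C , _ , u , _ , f₁≈) s*) with reduction-in-ideal s*
  ... | hs , hs∈G , f₁-f′≈ = (embΛ C *ₚ termX u (mt /ₘ lmg) , g) ∷ hs , g∈G ∷ hs∈G , coeff-eq
    where
    open Redex r
    open ℤ-Solver
    P rest : PolyLX
    P = (embΛ C *ₚ termX u (mt /ₘ lmg)) *ₚ embX g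
    rest = foldr (λ hg p → (proj₁ hg *ₚ embX (proj₂ hg)) +ₚ p) 0ₚ hs
    f-P≡ₘf₁ : ∀ μ x → ΣLX f (μ , x) - ΣLX P (μ , x) ≡ₘ ΣLX f₁ (μ , x)
    f-P≡ₘf₁ μ x = mk≡ₘ (sym (trans (sym (coeffLX≡red f₁ μ x)) (trans (f₁≈ μ x) (coeffLX-ₚ f P μ x))))
    f₁-f′≡ₘrest : ∀ μ x → ΣLX f₁ (μ , x) - ΣLX f′ (μ , x) ≡ₘ ΣLX rest (μ , x)
    f₁-f′≡ₘrest μ x = mk≡ₘ (trans (sym (coeffLX-ₚ f₁ f′ μ x)) (trans (f₁-f′≈ μ x) (coeffLX≡red rest μ x)))
    split : ∀ w → ΣLX f w - ΣLX f′ w ≡ₘ ΣLX P w + ΣLX rest w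
    split w@(μ , x) = begin
      ΣLX f w - ΣLX f′ w                           ≡⟨ solve 3 (λ a b p → a :- b := p :+ ((a :- p) :- b)) refl (ΣLX f w) (ΣLX f′ w) (ΣLX P w) ⟩
      ΣLX P w + ((ΣLX f w - ΣLX P w) - ΣLX f′ w)   ≈⟨ +-congʳₘ (ΣLX P w) (+-congˡₘ (- ΣLX f′ w) (f-P≡ₘf₁ μ x)) ⟩
      ΣLX P w + (ΣLX f₁ w - ΣLX f′ w)              ≈⟨ +-congʳₘ (ΣLX P w) (f₁-f′≡ₘrest μ x) ⟩
      ΣLX P w + ΣLX rest w                         ∎
      where open ≡ₘ-Reasoning
    coeff-eq : ∀ μ x → coeffLX (f -ₚ f′) μ x ≡ coeffLX (P ++ rest) μ x
    coeff-eq μ x = begin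
      coeffLX (f -ₚ f′) μ x                  ≡⟨ coeffLX-ₚ f f′ μ x ⟩
      red d (ΣLX f (μ , x) - ΣLX f′ (μ , x))  ≡⟨ red-≡ (split (μ , x)) ⟩
      red d (ΣLX P (μ , x) + ΣLX rest (μ , x)) ≡⟨ cong (red d) (sym (ΣLX-++ P rest (μ , x))) ⟩
      red d (ΣLX (P ++ rest) (μ , x))        ≡⟨ sym (coeffLX≡red (P ++ rest) μ x) ⟩
      coeffLX (P ++ rest) μ x                ∎
      where open ≡-Reasoning

  normal-form-lt : ∀ {f′} → Irreducible f′ → ∀ T → IsLT f′ T → ∀ g → g ∈ G → ∀ x → IsLMX g x →
                   ¬ InPrincipal T (termX (coeffX g x) x)
  normal-form-lt {f′} irreducible T (x₀ , (occ , _) , T≡f′ , _) g g∈G x isLM (h , T≈) = irreducible redex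
    where
    lc K : ℕ
    lc = coeffX g x
    K  = ν₂ lc
    νK : ν₂≡ d lc K
    νK = ν₂-correct (coeffX<N g x) (proj₁ isLM)
    coeff-via-h : ∀ μ → coeffLX f′ μ x₀ ≡ red d (ΣLX (h *ₚ termX lc x) (μ , x₀))
    coeff-via-h μ = trans (sym (T≡f′ μ)) (trans (T≈ μ x₀) (coeffLX≡red (h *ₚ termX lc x) μ x₀))
    x∣x₀ : x ∣ₘ x₀
    x∣x₀ = decidable-stable (x ∣ₘ? x₀) λ x∤x₀ →
      proj₂ occ (trans (coeff-via-h (proj₁ occ)) (trans (cong (red d) (ΣLX-*ₚtermX-∤ h lc x (proj₁ occ) x₀ x∤x₀)) red-zero))
    2^K∣coeff : ∀ μ → 2 ^ K ∣ coeffLX f′ μ x₀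
    2^K∣coeff μ = subst (2 ^ K ∣_) (sym (trans (coeff-via-h μ) (cong (red d) (trans eq z*lc≡))))
                        (2^j∣red[w*2^j] (z * + (lc div2^ K)) (ν₂≡⇒≤d (coeffX<N g x) νK))
      where
      z : ℤ
      z = proj₁ (ΣLX-*ₚtermX-multiple h lc x μ x₀)
      eq : ΣLX (h *ₚ termX lc x) (μ , x₀) ≡ z * + lc
      eq = proj₂ (ΣLX-*ₚtermX-multiple h lc x μ x₀)
      z*lc≡ : z * + lc ≡ z * + (lc div2^ K) * + 2 ^ K
      z*lc≡ = trans (cong (λ t → z * + t) (ν₂≡-split νK))
                    (trans (cong (z *_) (ℤP.pos-* (lc div2^ K) (2 ^ K))) (sym (ℤP.*-assoc z (+ (lc div2^ K)) (+ 2 ^ K))))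
    k̄ : ℕ
    k̄ = proj₁ (ν̄₂-exists f′ occ)
    ν̄₂≡k̄ : ν̄₂≡ d (coeffL f′ x₀) k̄
    ν̄₂≡k̄ = proj₂ (ν̄₂-exists f′ occ)
    K≤k̄ : K ℕ.≤ k̄
    K≤k̄ = let μ₁ , (_ , _ , max) = proj₁ ν̄₂≡k̄ in max K (∣⇒∣ᵣ K (coeffLX<N f′ μ₁ x₀) (2^K∣coeff μ₁))
    redex : Redex f′
    redex = record { g = g ; g∈G = g∈G ; lmg = x ; isLM = isLM ; mt = x₀ ; occurs = occ ; divides = x∣x₀
                   ; k = K ; νk = νK ; kbar = k̄ ; νbar = ν̄₂≡k̄ ; k≤kbar = K≤k̄ }

lemma2 : (d : ℕ) → 1 ≤ d → (m n : ℕ) (O : MonomialOrder n)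
         (G : List (Polys.PolyX d m n)) → All (λ g → ¬ Polys._≈X_ d m n g []) G →
         let open Polys d m n
             open WithOrder O
             open Procedure G
         in
         -- termination: there is no infinite sequence of reduction steps
         WellFounded (λ f' f → Step f f')
         -- the procedure returns a result on every input
         × (∀ f → ∃[ f' ] (Star Step f f' × Irreducible f'))
         -- (1) PNF_G(0) = 0
         × (∀ f f' → f ≈ 0ₚ → Star Step f f' → Irreducible f' → f' ≈ 0ₚ)
         -- (2) lt(PNF_G(f)) ∉ ⟨lt(g)⟩ for every g ∈ G, when PNF_G(f) ≠ 0
         × (∀ f f' → Star Step f f' → Irreducible f' → ¬ (f' ≈ 0ₚ) →
              ∀ T → IsLT f' T → ∀ g → g ∈ G → ∀ x → IsLMX g x →
              ¬ InPrincipal T (termX (coeffX g x) x))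
         -- (3) f − PNF_G(f) ∈ ⟨G⟩
         × (∀ f f' → Star Step f f' → Irreducible f' → InIdeal (f -ₚ f') G)
lemma2 d _ m n O G _ =
  step-wellFounded ,
  (λ f → normal-form f (step-wellFounded f)) ,
  (λ _ _ f≈0 s* _ → zero-normal-form f≈0 s*) ,
  (λ _ _ _ irreducible _ → normal-form-lt irreducible) ,
  (λ _ _ s* _ → reduction-in-ideal s*)
  where open NormalForm d m n O G
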